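{- Let $k\geq 2$ and $n$ be positive integers and let $a_1<a_2<\cdots<a_k$ be positive integers satisfying $\frac{n}{2^{n}}=\sum_{i=1}^{k}\frac{a_{i}}{2^{a_{i}}}$. Then $$a_k\leq 2^{k+2}+2k(\log_2 k-1)-4.$$ In particular, for each fixed $k$ the equation has only finitely many solutions $(n,a_1,\ldots,a_k)$.
   Context: The equation $\frac{n}{2^{n}}=\sum_{i=1}^{k}\frac{a_{i}}{2^{a_{i}}}$ is considered in positive integers $n,k,a_1,\ldots,a_k$ with $k\geq 2$ and $a_1<\cdots<a_k$. -}

module Defs where

open import Data.Nat using (ℕ; zero; suc; _+_; _*_; _∸_; _^_; _≤_)
open import Data.Nat.Properties using (m^n≢0)
open import Data.Fin using (Fin; zero; suc)
open import Data.Integer using (+_)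
open import Data.Rational using (ℚ; 0ℚ; _/_) renaming (_+_ to _+ℚ_)

term : ℕ → ℚ
term a = (+ a) / (2 ^ a)
  where instance _ = m^n≢0 2 a

sumℚ : ∀ {k} → (Fin k → ℚ) → ℚ
sumℚ {zero}  f = 0ℚ
sumℚ {suc k} f = f zero +ℚ sumℚ (λ i → f (suc i))

-- For k ≥ 2 and a natural x:
--   x ≤ 2^(k+2) + 2k(log₂ k - 1) - 4   (real inequality)
-- ⟺ x + 4 + 2k - 2^(k+2) ≤ 2k log₂ k
-- ⟺ 2^((x + 4 + 2k) ∸ 2^(k+2)) ≤ k^(2k)
-- (if the integer x+4+2k-2^(k+2) is ≤ 0 both sides hold; otherwise take 2^·
--  of both sides).
BelowBound : ℕ → ℕ → Set
BelowBound k x = 2 ^ ((x + 4 + 2 * k) ∸ 2 ^ (k + 2)) ≤ k ^ (2 * k)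

{-# OPTIONS --safe #-}
module Submission where

-- Put E = n + a_k and clear denominators: the equation becomes the
-- integer identity s n = s a_1 + ⋯ + s a_k for s x = x·2^(E−x), and s is
-- decreasing on [1, E].  Hence n < a_1, and comparing with the largest
-- possible right-hand side, a_i = n + i (a telescoping sum), gives
-- n + k + 2 ≤ 2^(k+1).  Next, 2^(E−n) divides the sum.  If 2^(E−p) divides
-- the part of the sum starting at a_j > p, that part is at least 2^(E−p)
-- and at most k·s a_j, so 2^g ≤ k(p + g) for the gap g = a_j − p; as long
-- as p + 2k ≤ 2^(k+1) + 2k² − k − 2 this forces g ≤ 2k.  Then 2^(E−a_j)
-- divides the rest of the sum and one moves on to a_(j+1).  This gives
-- a_k ≤ n + 2k² ≤ 2^(k+1) + 2k² − k − 2, which implies the stated bound.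

open import Defs
open import Algebra.Properties.Monoid.Sum using (sum; sum-cong-≗)
open import Data.Bool.Base using (T)
open import Data.Fin.Base using (Fin; zero; suc; toℕ; fromℕ)
  renaming (_<_ to _<ᶠ_; _≤_ to _≤ᶠ_)
open import Data.Fin.Properties using (≤fromℕ; toℕ-fromℕ)
  renaming (_≟_ to _≟ᶠ_; ≤∧≢⇒< to ≤∧≢⇒<ᶠ)
open import Data.Integer.Base as ℤ using (+_)
import Data.Integer.Properties as ℤᴾ
import Data.Integer.Tactic.RingSolver as ℤ-Solver
import Algebra.Properties.CommutativeSemigroup as CommSemigroupProperties
open import Data.Integer.GCD using (gcd)
open import Data.Nat.Base hiding (_/_)
open import Data.Nat.Properties
open import Data.Nat.Divisibility using (_∣_; divides; n∣m*n; ∣-trans; ∣m+n∣m⇒∣n; ∣⇒≤)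
open import Data.Nat.Tactic.RingSolver using (solve-∀)
open import Data.Product.Base using (_×_; _,_; proj₁; proj₂; Σ)
open import Data.Rational.Base as ℚ using (ℚ; 0ℚ; _/_; ↥_; ↧_)
import Data.Rational.Properties as ℚᴾ
open import Function.Base using (_∘_)
open import Relation.Binary.PropositionalEquality
open import Relation.Nullary.Decidable using (yes; no)

private
  ∑ : ∀ {k} → (Fin k → ℕ) → ℕ
  ∑ = sum +-0-monoid
  module ℕ* = CommSemigroupProperties *-commutativeSemigroup
  module ℤ* = CommSemigroupProperties ℤᴾ.*-commutativeSemigroup

↥/-cross : ∀ i d .{{_ : NonZero d}} → ↥ (i / d) ℤ.* + d ≡ i ℤ.* ↧ (i / d)
↥/-cross i d = begin
  ↥ q ℤ.* + d          ≡⟨ cong (↥ q ℤ.*_) (ℚᴾ.↧-/ i d) ⟨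
  ↥ q ℤ.* (↧ q ℤ.* g)  ≡⟨ ℤ*.x∙yz≈xz∙y (↥ q) (↧ q) g ⟩
  ↥ q ℤ.* g ℤ.* ↧ q    ≡⟨ cong (ℤ._* ↧ q) (ℚᴾ.↥-/ i d) ⟩
  i ℤ.* ↧ q            ∎
  where
  open ≡-Reasoning
  q : ℚ
  q = i / d
  g : ℤ.ℤ
  g = gcd i (+ d)

infix 4 _≐_÷_

-- q = x / d, cross-multiplied, so that x / d need not be in lowest terms.
record _≐_÷_ (q : ℚ) (x d : ℕ) : Set where
  constructor mk≐
  field cross : ↥ q ℤ.* + d ≡ + x ℤ.* ↧ q

/-≐ : ∀ x d .{{_ : NonZero d}} → (+ x) / d ≐ x ÷ d
/-≐ x d = mk≐ (↥/-cross (+ x) d)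

0-≐ : ∀ d → 0ℚ ≐ 0 ÷ d
0-≐ d = mk≐ refl

+-≐ : ∀ {p q x y d} → p ≐ x ÷ d → q ≐ y ÷ d → p ℚ.+ q ≐ x + y ÷ d
+-≐ {p@record{}} {q@record{}} {x} {y} {d} (mk≐ p≐) (mk≐ q≐) =
  mk≐ (ℤᴾ.*-cancelʳ-≡ _ _ (↧ p ℤ.* ↧ q) (begin
    ↥ s ℤ.* + d ℤ.* (↧ p ℤ.* ↧ q)
      ≡⟨ ℤ*.xy∙z≈xz∙y (↥ s) (+ d) _ ⟩
    ↥ s ℤ.* (↧ p ℤ.* ↧ q) ℤ.* + d
      ≡⟨ cong (ℤ._* + d) (↥/-cross (↥ p ℤ.* ↧ q ℤ.+ ↥ q ℤ.* ↧ p) (ℚ.↧ₙ p * ℚ.↧ₙ q)) ⟩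
    (↥ p ℤ.* ↧ q ℤ.+ ↥ q ℤ.* ↧ p) ℤ.* ↧ s ℤ.* + d
      ≡⟨ expand (↥ p) (↥ q) (↧ p) (↧ q) (↧ s) (+ d) ⟩
    (↥ p ℤ.* + d ℤ.* ↧ q ℤ.+ ↥ q ℤ.* + d ℤ.* ↧ p) ℤ.* ↧ s
      ≡⟨ cong₂ (λ u v → (u ℤ.* ↧ q ℤ.+ v ℤ.* ↧ p) ℤ.* ↧ s) p≐ q≐ ⟩
    (+ x ℤ.* ↧ p ℤ.* ↧ q ℤ.+ + y ℤ.* ↧ q ℤ.* ↧ p) ℤ.* ↧ s
      ≡⟨ collect (+ x) (+ y) (↧ p) (↧ q) (↧ s) ⟩
    (+ x ℤ.+ + y) ℤ.* ↧ s ℤ.* (↧ p ℤ.* ↧ q)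
      ≡⟨ cong (λ z → z ℤ.* ↧ s ℤ.* (↧ p ℤ.* ↧ q)) (ℤᴾ.pos-+ x y) ⟨
    + (x + y) ℤ.* ↧ s ℤ.* (↧ p ℤ.* ↧ q) ∎))
  where
  open ≡-Reasoning
  s : ℚ
  s = p ℚ.+ q
  expand : ∀ a b c e f h →
           (a ℤ.* e ℤ.+ b ℤ.* c) ℤ.* f ℤ.* h ≡ (a ℤ.* h ℤ.* e ℤ.+ b ℤ.* h ℤ.* c) ℤ.* f
  expand = ℤ-Solver.solve-∀
  collect : ∀ a b c e f →
            (a ℤ.* c ℤ.* e ℤ.+ b ℤ.* e ℤ.* c) ℤ.* f ≡ (a ℤ.+ b) ℤ.* f ℤ.* (c ℤ.* e)
  collect = ℤ-Solver.solve-∀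

≐-scale : ∀ {q x d} c → q ≐ x ÷ d → q ≐ x * c ÷ d * c
≐-scale {q} {x} {d} c (mk≐ q≐) = mk≐ (begin
  ↥ q ℤ.* + (d * c)        ≡⟨ cong (↥ q ℤ.*_) (ℤᴾ.pos-* d c) ⟩
  ↥ q ℤ.* (+ d ℤ.* + c)    ≡⟨ ℤᴾ.*-assoc (↥ q) (+ d) (+ c) ⟨
  ↥ q ℤ.* + d ℤ.* + c      ≡⟨ cong (ℤ._* + c) q≐ ⟩
  + x ℤ.* ↧ q ℤ.* + c      ≡⟨ ℤ*.xy∙z≈xz∙y (+ x) (↧ q) (+ c) ⟩
  + x ℤ.* + c ℤ.* ↧ q      ≡⟨ cong (ℤ._* ↧ q) (ℤᴾ.pos-* x c) ⟨
  + (x * c) ℤ.* ↧ q        ∎)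
  where open ≡-Reasoning

≐-injective : ∀ {q x y d} → q ≐ x ÷ d → q ≐ y ÷ d → x ≡ y
≐-injective {q@record{}} (mk≐ x≐) (mk≐ y≐) =
  ℤᴾ.+-injective (ℤᴾ.*-cancelʳ-≡ _ _ (↧ q) (trans (sym x≐) y≐))

sumℚ-≐ : ∀ {k d} {f : Fin k → ℚ} {g : Fin k → ℕ} →
         (∀ i → f i ≐ g i ÷ d) → sumℚ f ≐ ∑ g ÷ d
sumℚ-≐ {zero}  {d} _   = 0-≐ d
sumℚ-≐ {suc k}     f≐g = +-≐ (f≐g zero) (sumℚ-≐ (f≐g ∘ suc))

-- Clearing denominators

-- 2^E · x / 2^x; only meaningful for x ≤ E, since E ∸ x truncates.
scaled : ℕ → ℕ → ℕ
scaled E x = x * 2 ^ (E ∸ x)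

term-≐ : ∀ {E x} → x ≤ E → term x ≐ scaled E x ÷ 2 ^ E
term-≐ {E} {x} x≤E =
  subst (term x ≐ scaled E x ÷_) 2^x*2^[E∸x]≡2^E
        (≐-scale (2 ^ (E ∸ x)) (/-≐ x (2 ^ x) {{m^n≢0 2 x}}))
  where
  2^x*2^[E∸x]≡2^E : 2 ^ x * 2 ^ (E ∸ x) ≡ 2 ^ E
  2^x*2^[E∸x]≡2^E = trans (sym (^-distribˡ-+-* 2 x (E ∸ x))) (cong (2 ^_) (m+[n∸m]≡n x≤E))

term≡sumℚ⇒scaled≡∑ : ∀ {k E n} (a : Fin k → ℕ) → n ≤ E → (∀ i → a i ≤ E) →
                     term n ≡ sumℚ (term ∘ a) → scaled E n ≡ ∑ (scaled E ∘ a)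
term≡sumℚ⇒scaled≡∑ a n≤E a≤E eq =
  ≐-injective (term-≐ n≤E) (subst (_≐ _ ÷ _) (sym eq) (sumℚ-≐ (term-≐ ∘ a≤E)))

∸-split : ∀ {p b E} → p ≤ b → b ≤ E → E ∸ p ≡ (b ∸ p) + (E ∸ b)
∸-split {p} {b} {E} p≤b b≤E = begin
  E ∸ p                ≡⟨ cong (_∸ p) (m∸n+n≡m b≤E) ⟨
  (E ∸ b) + b ∸ p      ≡⟨ +-∸-assoc (E ∸ b) p≤b ⟩
  (E ∸ b) + (b ∸ p)    ≡⟨ +-comm (E ∸ b) (b ∸ p) ⟩
  (b ∸ p) + (E ∸ b)    ∎
  where open ≡-Reasoning

scaled-suc-≤ : ∀ {E x} → 1 ≤ x → x < E → scaled E (suc x) ≤ scaled E x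
scaled-suc-≤ {E} {x} 1≤x x<E = begin
  suc x * 2 ^ (E ∸ suc x)        ≤⟨ *-monoˡ-≤ _ 1+x≤2x ⟩
  2 * x * 2 ^ (E ∸ suc x)        ≡⟨ ℕ*.xy∙z≈y∙xz 2 x _ ⟩
  x * (2 * 2 ^ (E ∸ suc x))      ≡⟨ cong (λ e → x * 2 ^ e) (+-∸-assoc 1 x<E) ⟨
  x * 2 ^ (E ∸ x)                ∎
  where
  open ≤-Reasoning
  1+x≤2x : suc x ≤ 2 * x
  1+x≤2x = ≤-trans (+-monoˡ-≤ x 1≤x) (≤-reflexive (cong (_+_ x) (sym (+-identityʳ x))))

scaled-antitone : ∀ {E x y} → 1 ≤ x → x ≤ y → y ≤ E → scaled E y ≤ scaled E x
scaled-antitone {E} {x} 1≤x x≤y = go (≤⇒≤′ x≤y)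
  where
  go : ∀ {y} → x ≤′ y → y ≤ E → scaled E y ≤ scaled E x
  go ≤′-refl           _    = ≤-refl
  go (≤′-step x≤′y) 1+y≤E =
    ≤-trans (scaled-suc-≤ (≤-trans 1≤x (≤′⇒≤ x≤′y)) 1+y≤E) (go x≤′y (<⇒≤ 1+y≤E))

scaled-positive : ∀ {E x} → 1 ≤ x → 1 ≤ scaled E x
scaled-positive {E} {x} 1≤x = *-mono-≤ 1≤x (m^n>0 2 (E ∸ x))

∑-cong : ∀ {k} (f g : Fin k → ℕ) → (∀ i → f i ≡ g i) → ∑ f ≡ ∑ g
∑-cong _ _ = sum-cong-≗ +-0-monoid

∑-mono-≤ : ∀ {k} (f g : Fin k → ℕ) → (∀ i → f i ≤ g i) → ∑ f ≤ ∑ g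
∑-mono-≤ {zero}  _ _ _   = z≤n
∑-mono-≤ {suc k} f g f≤g = +-mono-≤ (f≤g zero) (∑-mono-≤ (f ∘ suc) (g ∘ suc) (f≤g ∘ suc))

∑-≤-* : ∀ {k c} (f : Fin k → ℕ) → (∀ i → f i ≤ c) → ∑ f ≤ k * c
∑-≤-* {zero}  _ _   = z≤n
∑-≤-* {suc k} f f≤c = +-mono-≤ (f≤c zero) (∑-≤-* (f ∘ suc) (f≤c ∘ suc))

Increasing : ∀ {k} → (Fin k → ℕ) → Set
Increasing b = ∀ i j → i <ᶠ j → b i < b j

Increasing-tail : ∀ {k} {b : Fin (suc k) → ℕ} → Increasing b → Increasing (b ∘ suc)
Increasing-tail inc i j i<j = inc (suc i) (suc j) (s≤s i<j)

Increasing⇒monotone : ∀ {k} {b : Fin k → ℕ} → Increasing b → ∀ {i j} → i ≤ᶠ j → b i ≤ b j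
Increasing⇒monotone inc {i} {j} i≤j with i ≟ᶠ j
... | yes refl = ≤-refl
... | no  i≢j  = <⇒≤ (inc i j (≤∧≢⇒<ᶠ i≤j i≢j))

Increasing⇒head+toℕ≤ : ∀ {k} {b : Fin (suc k) → ℕ} → Increasing b → ∀ i → b zero + toℕ i ≤ b i
Increasing⇒head+toℕ≤ {b = b} _ zero = ≤-reflexive (+-identityʳ (b zero))
Increasing⇒head+toℕ≤ {suc _} {b} inc (suc i) = begin
  b zero + suc (toℕ i)    ≡⟨ +-suc (b zero) (toℕ i) ⟩
  suc (b zero) + toℕ i    ≤⟨ +-monoˡ-≤ (toℕ i) (inc zero (suc zero) z<s) ⟩
  b (suc zero) + toℕ i    ≤⟨ Increasing⇒head+toℕ≤ (Increasing-tail inc) i ⟩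
  b (suc i)               ∎
  where open ≤-Reasoning

-- The bound on n

scaled≡∑⇒<head : ∀ {E n r} (b : Fin (suc (suc r)) → ℕ) → (∀ i → 1 ≤ b i) → n ≤ E →
                 scaled E n ≡ ∑ (scaled E ∘ b) → n < b zero
scaled≡∑⇒<head {E} {n} b 1≤b n≤E eq = ≰⇒> λ b₀≤n → <-irrefl refl (begin-strict
  scaled E n                                  ≤⟨ scaled-antitone (1≤b zero) b₀≤n n≤E ⟩
  scaled E (b zero)                           <⟨ m<m+n _ (≤-trans (scaled-positive (1≤b (suc zero)))
                                                                      (m≤m+n _ _)) ⟩
  scaled E (b zero) + ∑ (scaled E ∘ b ∘ suc)  ≡⟨ eq ⟨
  scaled E n                                  ∎)
  where open ≤-Reasoning

telescope : ∀ {E} p r → p + r ≤ E →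
            ∑ (λ (i : Fin r) → scaled E (suc p + toℕ i)) + (p + r + 2) * 2 ^ (E ∸ (p + r))
              ≡ (p + 2) * 2 ^ (E ∸ p)
telescope p zero _ rewrite +-identityʳ p = refl
telescope {E} p (suc r) p+1+r≤E = begin
  scaled E (suc p + 0) + S + R (p + suc r)
    ≡⟨ cong₂ (λ x y → scaled E x + S + R y) (+-identityʳ (suc p)) (+-suc p r) ⟩
  scaled E (suc p) + S + R (suc p + r)
    ≡⟨ +-assoc (scaled E (suc p)) S (R (suc p + r)) ⟩
  scaled E (suc p) + (S + R (suc p + r))
    ≡⟨ cong (λ z → scaled E (suc p) + (z + R (suc p + r))) S≡ ⟩
  scaled E (suc p) + (∑ (λ (i : Fin r) → scaled E (suc (suc p) + toℕ i)) + R (suc p + r))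
    ≡⟨ cong (_+_ (scaled E (suc p))) (telescope {E} (suc p) r 1+p+r≤E) ⟩
  suc p * Y + (suc p + 2) * Y
    ≡⟨ regroup p Y ⟩
  (p + 2) * (2 * Y)
    ≡⟨ cong (λ e → (p + 2) * 2 ^ e) (+-∸-assoc 1 (≤-trans (s≤s (m≤m+n p r)) 1+p+r≤E)) ⟨
  R p ∎
  where
  open ≡-Reasoning
  R : ℕ → ℕ
  R q = (q + 2) * 2 ^ (E ∸ q)
  1+p+r≤E : suc p + r ≤ E
  1+p+r≤E = subst (_≤ E) (+-suc p r) p+1+r≤E
  S : ℕ
  S = ∑ (λ (i : Fin r) → scaled E (suc p + suc (toℕ i)))
  S≡ : S ≡ ∑ (λ (i : Fin r) → scaled E (suc (suc p) + toℕ i))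
  S≡ = ∑-cong (λ (i : Fin r) → scaled E (suc p + suc (toℕ i))) (λ i → scaled E (suc (suc p) + toℕ i))
               (λ i → cong (scaled E) (+-suc (suc p) (toℕ i)))
  Y : ℕ
  Y = 2 ^ (E ∸ suc p)
  regroup : ∀ a y → suc a * y + (suc a + 2) * y ≡ (a + 2) * (2 * y)
  regroup = solve-∀

scaled≡∑⇒n+k+2≤2^[1+k] : ∀ {E n k} (b : Fin k → ℕ) → n + k ≤ E → (∀ i → suc n + toℕ i ≤ b i) →
                          (∀ i → b i ≤ E) → scaled E n ≡ ∑ (scaled E ∘ b) → n + k + 2 ≤ 2 ^ suc k
scaled≡∑⇒n+k+2≤2^[1+k] {E} {n} {k} b n+k≤E n+i<b b≤E eq =
  *-cancelʳ-≤ (n + k + 2) (2 ^ suc k) Y {{m^n≢0 2 (E ∸ (n + k))}}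
    (+-cancelˡ-≤ (n * Z) _ _ (begin
      n * Z + (n + k + 2) * Y
        ≤⟨ +-monoˡ-≤ _ (≤-trans (≤-reflexive eq) ∑≤telescoping) ⟩
      ∑ (λ (i : Fin k) → scaled E (suc n + toℕ i)) + (n + k + 2) * Y
        ≡⟨ telescope {E} n k n+k≤E ⟩
      (n + 2) * Z
        ≡⟨ *-distribʳ-+ Z n 2 ⟩
      n * Z + 2 * Z
        ≡⟨ cong (λ z → n * Z + 2 * z) Z≡2^k*Y ⟩
      n * Z + 2 * (2 ^ k * Y)
        ≡⟨ cong (_+_ (n * Z)) (*-assoc 2 (2 ^ k) Y) ⟨
      n * Z + 2 ^ suc k * Y ∎))
  where
  open ≤-Reasoning
  Y Z : ℕ
  Y = 2 ^ (E ∸ (n + k))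
  Z = 2 ^ (E ∸ n)
  ∑≤telescoping : ∑ (scaled E ∘ b) ≤ ∑ (λ (i : Fin k) → scaled E (suc n + toℕ i))
  ∑≤telescoping = ∑-mono-≤ (scaled E ∘ b) _ (λ i → scaled-antitone z<s (n+i<b i) (b≤E i))
  Z≡2^k*Y : Z ≡ 2 ^ k * Y
  Z≡2^k*Y = begin-equality
    2 ^ (E ∸ n)                     ≡⟨ cong (2 ^_) (∸-split (m≤m+n n k) n+k≤E) ⟩
    2 ^ (n + k ∸ n + (E ∸ (n + k))) ≡⟨ cong (λ e → 2 ^ (e + (E ∸ (n + k)))) (m+n∸m≡n n k) ⟩
    2 ^ (k + (E ∸ (n + k)))         ≡⟨ ^-distribˡ-+-* 2 k _ ⟩
    2 ^ k * Y                       ∎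

-- The gaps

*-+<2^-suc : ∀ {k A h} → 1 ≤ A + h → k * (A + h) < 2 ^ h → k * (A + suc h) < 2 ^ suc h
*-+<2^-suc {k} {A} {h} 1≤A+h lt = begin-strict
  k * (A + suc h)          ≡⟨ cong (k *_) (+-suc A h) ⟩
  k * suc (A + h)          ≡⟨ *-suc k (A + h) ⟩
  k + k * (A + h)          ≤⟨ +-monoˡ-≤ _ (m≤m*n k (A + h) {{>-nonZero 1≤A+h}}) ⟩
  k * (A + h) + k * (A + h) <⟨ +-mono-< lt lt ⟩
  2 ^ h + 2 ^ h            ≡⟨ cong (_+_ (2 ^ h)) (+-identityʳ (2 ^ h)) ⟨
  2 ^ suc h                ∎
  where open ≤-Reasoning

gap-≤ : ∀ {k A G g} → k * (A + suc G) < 2 ^ suc G → 2 ^ g ≤ k * (A + g) → g ≤ G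
gap-≤ {k} {A} {G} {g} base 2^g≤ = ≮⇒≥ (λ G<g → <⇒≱ (beyond (≤⇒≤′ G<g)) 2^g≤)
  where
  beyond : ∀ {h} → suc G ≤′ h → k * (A + h) < 2 ^ h
  beyond ≤′-refl             = base
  beyond (≤′-step {h} G<h) =
    *-+<2^-suc {k} {A} {h} (≤-trans (≤-trans z<s (≤′⇒≤ G<h)) (m≤n+m h A)) (beyond G<h)

module _ {E : ℕ} {r p : ℕ} (b : Fin (suc r) → ℕ) (inc : Increasing b)
         (b≤E : ∀ i → b i ≤ E) (p<b₀ : p < b zero) where

  private
    b₀ : ℕ
    b₀ = b zero
    split : 2 ^ (E ∸ p) ≡ 2 ^ (b₀ ∸ p) * 2 ^ (E ∸ b₀)
    split = trans (cong (2 ^_) (∸-split (<⇒≤ p<b₀) (b≤E zero))) (^-distribˡ-+-* 2 (b₀ ∸ p) (E ∸ b₀))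

  ∣∑⇒2^gap≤ : 2 ^ (E ∸ p) ∣ ∑ (scaled E ∘ b) → 2 ^ (b₀ ∸ p) ≤ suc r * b₀
  ∣∑⇒2^gap≤ 2^[E∸p]∣ = *-cancelʳ-≤ _ _ (2 ^ (E ∸ b₀)) {{m^n≢0 2 (E ∸ b₀)}} (begin
    2 ^ (b₀ ∸ p) * 2 ^ (E ∸ b₀)  ≡⟨ split ⟨
    2 ^ (E ∸ p)                  ≤⟨ ∣⇒≤ {{>-nonZero ∑-positive}} 2^[E∸p]∣ ⟩
    ∑ (scaled E ∘ b)             ≤⟨ ∑-≤-* (scaled E ∘ b) b≤b₀ ⟩
    suc r * scaled E b₀          ≡⟨ *-assoc (suc r) b₀ _ ⟨
    suc r * b₀ * 2 ^ (E ∸ b₀)    ∎)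
    where
    open ≤-Reasoning
    1≤b₀ : 1 ≤ b₀
    1≤b₀ = ≤-trans z<s p<b₀
    ∑-positive : 1 ≤ ∑ (scaled E ∘ b)
    ∑-positive = ≤-trans (scaled-positive 1≤b₀) (m≤m+n _ _)
    b≤b₀ : ∀ i → scaled E (b i) ≤ scaled E b₀
    b≤b₀ i = scaled-antitone 1≤b₀ (Increasing⇒monotone inc z≤n) (b≤E i)

  ∣∑⇒∣∑tail : 2 ^ (E ∸ p) ∣ scaled E b₀ + ∑ (scaled E ∘ b ∘ suc) →
              2 ^ (E ∸ b₀) ∣ ∑ (scaled E ∘ b ∘ suc)
  ∣∑⇒∣∑tail 2^[E∸p]∣ = ∣m+n∣m⇒∣n (∣-trans (divides (2 ^ (b₀ ∸ p)) split) 2^[E∸p]∣) (n∣m*n b₀)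

module _ {E k G Λ : ℕ} (k[1+Λ]<2^[1+G] : k * suc Λ < 2 ^ suc G) where

  ∣∑⇒head≤ : ∀ {r p} (b : Fin (suc r) → ℕ) → Increasing b → (∀ i → b i ≤ E) → suc r ≤ k →
             p < b zero → p + G ≤ Λ → 2 ^ (E ∸ p) ∣ ∑ (scaled E ∘ b) → b zero ≤ p + G
  ∣∑⇒head≤ {p = p} b inc b≤E 1+r≤k p<b₀ p+G≤Λ 2^[E∸p]∣ =
    subst (_≤ p + G) (m+[n∸m]≡n (<⇒≤ p<b₀)) (+-monoʳ-≤ p (gap-≤ {k} {p} {G} base 2^gap≤))
    where
    base : k * (p + suc G) < 2 ^ suc G
    base = ≤-<-trans (*-monoʳ-≤ k (≤-trans (≤-reflexive (+-suc p G)) (s≤s p+G≤Λ))) k[1+Λ]<2^[1+G]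
    2^gap≤ : 2 ^ (b zero ∸ p) ≤ k * (p + (b zero ∸ p))
    2^gap≤ = subst (λ z → 2 ^ (b zero ∸ p) ≤ k * z) (sym (m+[n∸m]≡n (<⇒≤ p<b₀)))
               (≤-trans (∣∑⇒2^gap≤ b inc b≤E p<b₀ 2^[E∸p]∣) (*-monoˡ-≤ _ 1+r≤k))

  ∣∑⇒last≤ : ∀ {r p} (b : Fin (suc r) → ℕ) → Increasing b → (∀ i → b i ≤ E) → suc r ≤ k →
             p < b zero → p + suc r * G ≤ Λ → 2 ^ (E ∸ p) ∣ ∑ (scaled E ∘ b) →
             b (fromℕ r) ≤ p + suc r * G
  ∣∑⇒last≤ {zero} {p} b inc b≤E 1≤k p<b₀ p+G≤Λ 2^[E∸p]∣ =
    subst (λ z → b zero ≤ p + z) (sym (+-identityʳ G))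
      (∣∑⇒head≤ b inc b≤E 1≤k p<b₀ (subst (λ z → p + z ≤ Λ) (+-identityʳ G) p+G≤Λ) 2^[E∸p]∣)
  ∣∑⇒last≤ {suc r} {p} b inc b≤E 2+r≤k p<b₀ p+G+rG≤Λ 2^[E∸p]∣ = begin
    b (suc (fromℕ r))          ≤⟨ ∣∑⇒last≤ (b ∘ suc) (Increasing-tail inc) (b≤E ∘ suc) (<⇒≤ 2+r≤k)
                                    (inc zero (suc zero) z<s) (≤-trans b₀+rG≤ p+G+rG≤Λ)
                                    (∣∑⇒∣∑tail b inc b≤E p<b₀ 2^[E∸p]∣) ⟩
    b zero + suc r * G         ≤⟨ b₀+rG≤ ⟩
    p + (G + suc r * G)        ∎
    where
    open ≤-Reasoning
    b₀≤ : b zero ≤ p + G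
    b₀≤ = ∣∑⇒head≤ b inc b≤E 2+r≤k p<b₀ (≤-trans (+-monoʳ-≤ p (m≤m+n G _)) p+G+rG≤Λ)
                   2^[E∸p]∣
    b₀+rG≤ : b zero + suc r * G ≤ p + (G + suc r * G)
    b₀+rG≤ = ≤-trans (+-monoˡ-≤ _ b₀≤) (≤-reflexive (+-assoc p G _))

-- The bound on a_k

-- 2^(k+1) − k − 2 bounds n, and each of the k gaps is at most 2k.
maxLast : ℕ → ℕ
maxLast k = 2 ^ suc k ∸ (k + 2) + k * (2 * k)

BelowBound-antitone : ∀ k {x y} → x ≤ y → BelowBound k y → BelowBound k x
BelowBound-antitone k x≤y =
  ≤-trans (^-monoʳ-≤ 2 (∸-monoˡ-≤ (2 ^ (k + 2)) (+-monoˡ-≤ (2 * k) (+-monoˡ-≤ 4 x≤y))))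

BelowBound⇒≤ : ∀ k {x} → BelowBound k x → x ≤ 2 ^ (k + 2) + k ^ (2 * k)
BelowBound⇒≤ k {x} below = begin
  x                                ≤⟨ ≤-trans (m≤m+n x 4) (m≤m+n (x + 4) (2 * k)) ⟩
  x + 4 + 2 * k                    ≤⟨ m≤n+m∸n _ (2 ^ (k + 2)) ⟩
  2 ^ (k + 2) + excess             ≤⟨ +-monoʳ-≤ _ (<⇒≤ (n<2^n excess)) ⟩
  2 ^ (k + 2) + 2 ^ excess         ≤⟨ +-monoʳ-≤ _ below ⟩
  2 ^ (k + 2) + k ^ (2 * k)        ∎
  where
  open ≤-Reasoning
  excess : ℕ
  excess = x + 4 + 2 * k ∸ 2 ^ (k + 2)
  n<2^n : ∀ n → n < 2 ^ n
  n<2^n zero    = z<s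
  n<2^n (suc n) = +-mono-≤ (m^n>0 2 n) (≤-trans (n<2^n n) (≤-reflexive (sym (+-identityʳ _))))

private
  ≤-by-evaluation : ∀ {m n} {_ : T (m ≤ᵇ n)} → m ≤ n
  ≤-by-evaluation {m} {n} {m≤ᵇn} = ≤ᵇ⇒≤ m n m≤ᵇn

square+k+2≤2^ : ∀ j → let k = 5 + j in k * k + k + 2 ≤ 2 ^ k
square+k+2≤2^ zero    = ≤-by-evaluation
square+k+2≤2^ (suc j) = begin
  suc k * suc k + suc k + 2        ≡⟨ expand k ⟩
  (k * k + k + 2) + (k + k + 2)    ≤⟨ +-mono-≤ ih (≤-trans (+-monoˡ-≤ 2 (+-monoˡ-≤ k (m≤m*n k k)))
                                                          ih) ⟩
  2 ^ k + 2 ^ k                    ≡⟨ cong (_+_ (2 ^ k)) (+-identityʳ (2 ^ k)) ⟨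
  2 ^ suc k                        ∎
  where
  open ≤-Reasoning
  k : ℕ
  k = 5 + j
  ih : k * k + k + 2 ≤ 2 ^ k
  ih = square+k+2≤2^ j
  expand : ∀ k → suc k * suc k + suc k + 2 ≡ (k * k + k + 2) + (k + k + 2)
  expand = solve-∀

maxLast-admissible : ∀ k → 2 ≤ k → k * suc (maxLast k) < 2 ^ suc (2 * k) × BelowBound k (maxLast k)
maxLast-admissible 1 (s≤s ())
maxLast-admissible 2 _ = ≤-by-evaluation , ≤-by-evaluation
maxLast-admissible 3 _ = ≤-by-evaluation , ≤-by-evaluation
maxLast-admissible 4 _ = ≤-by-evaluation , ≤-by-evaluation
maxLast-admissible (suc (suc (suc (suc (suc j))))) _ = k[1+maxLast]< , below
  where
  open ≤-Reasoning
  k u : ℕ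
  k = 5 + j
  u = 2 ^ k
  small : k * k + k + 2 ≤ u
  small = square+k+2≤2^ j
  regroup : ∀ u k → 2 * u + k * (2 * k) + 4 + 2 * k ≡ 2 * u + 2 * (k * k + k + 2)
  regroup = solve-∀
  regroup′ : ∀ k u → k * (u * 4) ≡ 2 * k * (2 * u)
  regroup′ = solve-∀
  N₀≤2u : 2 ^ suc k ∸ (k + 2) ≤ 2 * u
  N₀≤2u = m∸n≤m (2 ^ suc k) (k + 2)
  maxLast+4+2k≤ : maxLast k + 4 + 2 * k ≤ 2 ^ (k + 2)
  maxLast+4+2k≤ = begin
    maxLast k + 4 + 2 * k                  ≤⟨ +-monoˡ-≤ _ (+-monoˡ-≤ 4 (+-monoˡ-≤ _ N₀≤2u)) ⟩
    2 * u + k * (2 * k) + 4 + 2 * k        ≡⟨ regroup u k ⟩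
    2 * u + 2 * (k * k + k + 2)            ≤⟨ +-monoʳ-≤ (2 * u) (*-monoʳ-≤ 2 small) ⟩
    2 * u + 2 * u                          ≡⟨ *-distribʳ-+ u 2 2 ⟨
    4 * u                                  ≡⟨ *-comm 4 u ⟩
    u * 2 ^ 2                              ≡⟨ ^-distribˡ-+-* 2 k 2 ⟨
    2 ^ (k + 2)                            ∎
  below : BelowBound k (maxLast k)
  below = subst (λ e → 2 ^ e ≤ k ^ (2 * k)) (sym (m≤n⇒m∸n≡0 maxLast+4+2k≤)) (m^n>0 k (2 * k))
  2k<u : 2 * k < u
  2k<u = begin-strict
    2 * k            ≡⟨ cong (_+_ k) (+-identityʳ k) ⟩
    k + k            <⟨ m<m+n (k + k) z<s ⟩
    k + k + 2        ≤⟨ +-monoˡ-≤ 2 (+-monoˡ-≤ k (m≤m*n k k)) ⟩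
    k * k + k + 2    ≤⟨ small ⟩
    u                ∎
  2^[2k]≡u*u : 2 ^ (2 * k) ≡ u * u
  2^[2k]≡u*u = trans (^-distribˡ-+-* 2 k (k + 0)) (cong (λ e → u * 2 ^ e) (+-identityʳ k))
  k[1+maxLast]< : k * suc (maxLast k) < 2 ^ suc (2 * k)
  k[1+maxLast]< = begin-strict
    k * suc (maxLast k)  ≤⟨ *-monoʳ-≤ k (≤-trans (m<m+n (maxLast k) z<s)
                                                   (≤-trans (m≤m+n _ (2 * k)) maxLast+4+2k≤)) ⟩
    k * 2 ^ (k + 2)      ≡⟨ cong (k *_) (^-distribˡ-+-* 2 k 2) ⟩
    k * (u * 4)          ≡⟨ regroup′ k u ⟩
    2 * k * (2 * u)      <⟨ *-monoˡ-< (2 * u) {{m^n≢0 2 (suc k)}} 2k<u ⟩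
    u * (2 * u)          ≡⟨ ℕ*.x∙yz≈y∙xz u 2 u ⟩
    2 * (u * u)          ≡⟨ cong (2 *_) 2^[2k]≡u*u ⟨
    2 ^ suc (2 * k)      ∎

solution⇒bounds : ∀ m n (a : Fin (suc m) → ℕ) → 1 ≤ m → (∀ i → 1 ≤ a i) → Increasing a →
                  term n ≡ sumℚ (term ∘ a) → n < a zero × a (fromℕ m) ≤ maxLast (suc m)
solution⇒bounds m@(suc _) n a 1≤m 1≤a inc eq = n<a₀ , (begin
  a (fromℕ m)               ≤⟨ ∣∑⇒last≤ {G = 2 * k} k[1+maxLast]<2^[1+2k] a inc a≤E ≤-refl n<a₀
                                          (+-monoˡ-≤ _ n≤N₀) 2^[E∸n]∣∑ ⟩
  n + k * (2 * k)           ≤⟨ +-monoˡ-≤ _ n≤N₀ ⟩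
  maxLast k                 ∎)
  where
  open ≤-Reasoning
  k E : ℕ
  k = suc m
  E = n + a (fromℕ m)
  a≤E : ∀ i → a i ≤ E
  a≤E i = ≤-trans (Increasing⇒monotone inc (≤fromℕ i)) (m≤n+m _ n)
  eq′ : scaled E n ≡ ∑ (scaled E ∘ a)
  eq′ = term≡sumℚ⇒scaled≡∑ a (m≤m+n n _) a≤E eq
  2^[E∸n]∣∑ : 2 ^ (E ∸ n) ∣ ∑ (scaled E ∘ a)
  2^[E∸n]∣∑ = subst (2 ^ (E ∸ n) ∣_) eq′ (n∣m*n n)
  k[1+maxLast]<2^[1+2k] : k * suc (maxLast k) < 2 ^ suc (2 * k)
  k[1+maxLast]<2^[1+2k] = proj₁ (maxLast-admissible k (s≤s 1≤m))
  n<a₀ : n < a zero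
  n<a₀ = scaled≡∑⇒<head a 1≤a (m≤m+n n _) eq′
  n+i<a : ∀ i → suc n + toℕ i ≤ a i
  n+i<a i = ≤-trans (+-monoˡ-≤ (toℕ i) n<a₀) (Increasing⇒head+toℕ≤ inc i)
  n+k≤E : n + k ≤ E
  n+k≤E = begin
    n + suc m                 ≡⟨ +-suc n m ⟩
    suc n + m                 ≡⟨ cong (_+_ (suc n)) (toℕ-fromℕ m) ⟨
    suc n + toℕ (fromℕ m)     ≤⟨ n+i<a (fromℕ m) ⟩
    a (fromℕ m)               ≤⟨ m≤n+m _ n ⟩
    E                         ∎
  n≤N₀ : n ≤ 2 ^ suc k ∸ (k + 2)
  n≤N₀ = m+n≤o⇒m≤o∸n n (≤-trans (≤-reflexive (sym (+-assoc n k 2)))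
           (scaled≡∑⇒n+k+2≤2^[1+k] a n+k≤E n+i<a a≤E eq′))

solution⇒BelowBound : ∀ m n (a : Fin (suc m) → ℕ) → 1 ≤ m → (∀ i → 1 ≤ a i) → Increasing a →
                      term n ≡ sumℚ (term ∘ a) → BelowBound (suc m) (a (fromℕ m))
solution⇒BelowBound m n a 1≤m 1≤a inc eq =
  BelowBound-antitone (suc m) (proj₂ (solution⇒bounds m n a 1≤m 1≤a inc eq))
                      (proj₂ (maxLast-admissible (suc m) (s≤s 1≤m)))

corollary2p9 : ((m n : ℕ) (a : Fin (suc m) → ℕ) → 1 ≤ m → 1 ≤ n
                 → (∀ i → 1 ≤ a i) → (∀ i j → i <ᶠ j → a i < a j)
                 → term n ≡ sumℚ (λ i → term (a i))
                 → BelowBound (suc m) (a (fromℕ m)))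
               × ((m : ℕ) → 1 ≤ m → Σ ℕ (λ B → (n : ℕ) (a : Fin (suc m) → ℕ) → 1 ≤ n
                 → (∀ i → 1 ≤ a i) → (∀ i j → i <ᶠ j → a i < a j)
                 → term n ≡ sumℚ (λ i → term (a i))
                 → n ≤ B × (∀ i → a i ≤ B)))
corollary2p9 =
    (λ m n a 1≤m _ → solution⇒BelowBound m n a 1≤m)
  , λ m 1≤m → 2 ^ (suc m + 2) + suc m ^ (2 * suc m) , λ n a _ 1≤a inc eq →
      let a≤B : ∀ i → a i ≤ 2 ^ (suc m + 2) + suc m ^ (2 * suc m)
          a≤B i = ≤-trans (Increasing⇒monotone inc (≤fromℕ i))
                          (BelowBound⇒≤ (suc m) (solution⇒BelowBound m n a 1≤m 1≤a inc eq))
      in ≤-trans (<⇒≤ (proj₁ (solution⇒bounds m n a 1≤m 1≤a inc eq))) (a≤B zero) , a≤B
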